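{- If $G$ is a $(3P_1+P_2,\,K_4-e,\,K_4)$-free graph, then $\chi(G)\le 5$.
   Context: All graphs are finite and simple; $\chi$ is the chromatic number. $K_4-e$ is $K_4$ minus an edge; $3P_1+P_2$ is the disjoint union of three isolated vertices and an edge. "$(H_1,\dots,H_t)$-free" means no induced subgraph isomorphic to any $H_i$. -}

module Defs where

open import Data.Nat using (ℕ)
open import Data.Fin using (Fin; zero; suc)
open import Data.Bool using (Bool; true; false)
open import Data.Product using (Σ; _×_)
open import Relation.Binary.PropositionalEquality using (_≡_; _≢_)
open import Function.Definitions using (Injective)
open import Relation.Nullary using (¬_)

record Graph (n : ℕ) : Set where
  field
    adj   : Fin n → Fin n → Bool
    irrefl : ∀ v → adj v v ≡ false
    sym   : ∀ u v → adj u v ≡ adj v u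
open Graph public

_≤ᵢ_ : ∀ {k n} → Graph k → Graph n → Set
_≤ᵢ_ {k} {n} H G =
  Σ (Fin k → Fin n) λ f →
    Injective _≡_ _≡_ f × (∀ i j → adj G (f i) (f j) ≡ adj H i j)

_Free_ : ∀ {k n} → Graph n → Graph k → Set
G Free H = ¬ (H ≤ᵢ G)

ProperColouring : ∀ {n} → Graph n → (c : ℕ) → (Fin n → Fin c) → Set
ProperColouring G c col = ∀ u v → adj G u v ≡ true → col u ≢ col v

Colourable : ∀ {n} → Graph n → ℕ → Set
Colourable {n} G c = Σ (Fin n → Fin c) (ProperColouring G c)

k4adj : Fin 4 → Fin 4 → Bool
k4adj zero zero = false
k4adj (suc i) (suc j) = k4adj′ i j
  where
  k4adj′ : Fin 3 → Fin 3 → Bool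
  k4adj′ zero zero = false
  k4adj′ (suc zero) (suc zero) = false
  k4adj′ (suc (suc zero)) (suc (suc zero)) = false
  k4adj′ _ _ = true
k4adj _ _ = true

K4 : Graph 4
K4 = record { adj = k4adj ; irrefl = irr ; sym = sy }
  where
  irr : ∀ v → k4adj v v ≡ false
  irr zero = _≡_.refl
  irr (suc zero) = _≡_.refl
  irr (suc (suc zero)) = _≡_.refl
  irr (suc (suc (suc zero))) = _≡_.refl
  sy : ∀ u v → k4adj u v ≡ k4adj v u
  sy zero zero = _≡_.refl
  sy zero (suc zero) = _≡_.refl
  sy zero (suc (suc zero)) = _≡_.refl
  sy zero (suc (suc (suc zero))) = _≡_.refl
  sy (suc zero) zero = _≡_.refl
  sy (suc zero) (suc zero) = _≡_.refl
  sy (suc zero) (suc (suc zero)) = _≡_.refl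
  sy (suc zero) (suc (suc (suc zero))) = _≡_.refl
  sy (suc (suc zero)) zero = _≡_.refl
  sy (suc (suc zero)) (suc zero) = _≡_.refl
  sy (suc (suc zero)) (suc (suc zero)) = _≡_.refl
  sy (suc (suc zero)) (suc (suc (suc zero))) = _≡_.refl
  sy (suc (suc (suc zero))) zero = _≡_.refl
  sy (suc (suc (suc zero))) (suc zero) = _≡_.refl
  sy (suc (suc (suc zero))) (suc (suc zero)) = _≡_.refl
  sy (suc (suc (suc zero))) (suc (suc (suc zero))) = _≡_.refl

diamondAdj : Fin 4 → Fin 4 → Bool
diamondAdj zero (suc zero) = false
diamondAdj (suc zero) zero = false
diamondAdj u v = k4adj u v

K4-e : Graph 4
K4-e = record { adj = diamondAdj ; irrefl = irr ; sym = sy }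
  where
  irr : ∀ v → diamondAdj v v ≡ false
  irr zero = _≡_.refl
  irr (suc zero) = _≡_.refl
  irr (suc (suc zero)) = _≡_.refl
  irr (suc (suc (suc zero))) = _≡_.refl
  sy : ∀ u v → diamondAdj u v ≡ diamondAdj v u
  sy zero zero = _≡_.refl
  sy zero (suc zero) = _≡_.refl
  sy zero (suc (suc zero)) = _≡_.refl
  sy zero (suc (suc (suc zero))) = _≡_.refl
  sy (suc zero) zero = _≡_.refl
  sy (suc zero) (suc zero) = _≡_.refl
  sy (suc zero) (suc (suc zero)) = _≡_.refl
  sy (suc zero) (suc (suc (suc zero))) = _≡_.refl
  sy (suc (suc zero)) zero = _≡_.refl
  sy (suc (suc zero)) (suc zero) = _≡_.refl
  sy (suc (suc zero)) (suc (suc zero)) = _≡_.refl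
  sy (suc (suc zero)) (suc (suc (suc zero))) = _≡_.refl
  sy (suc (suc (suc zero))) zero = _≡_.refl
  sy (suc (suc (suc zero))) (suc zero) = _≡_.refl
  sy (suc (suc (suc zero))) (suc (suc zero)) = _≡_.refl
  sy (suc (suc (suc zero))) (suc (suc (suc zero))) = _≡_.refl

-- 3P1 + P2: vertices 0,1,2 isolated; single edge {3,4}.
p3p2Adj : Fin 5 → Fin 5 → Bool
p3p2Adj (suc (suc (suc zero))) (suc (suc (suc (suc zero)))) = true
p3p2Adj (suc (suc (suc (suc zero)))) (suc (suc (suc zero))) = true
p3p2Adj _ _ = false

3P1+P2 : Graph 5
3P1+P2 = record { adj = p3p2Adj ; irrefl = irr ; sym = sy }
  where
  irr : ∀ v → p3p2Adj v v ≡ false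
  irr zero = _≡_.refl
  irr (suc zero) = _≡_.refl
  irr (suc (suc zero)) = _≡_.refl
  irr (suc (suc (suc zero))) = _≡_.refl
  irr (suc (suc (suc (suc zero)))) = _≡_.refl
  sy : ∀ u v → p3p2Adj u v ≡ p3p2Adj v u
  sy (suc (suc (suc zero))) (suc (suc (suc (suc zero)))) = _≡_.refl
  sy (suc (suc (suc (suc zero)))) (suc (suc (suc zero))) = _≡_.refl
  sy zero zero = _≡_.refl
  sy zero (suc zero) = _≡_.refl
  sy zero (suc (suc zero)) = _≡_.refl
  sy zero (suc (suc (suc zero))) = _≡_.refl
  sy zero (suc (suc (suc (suc zero)))) = _≡_.refl
  sy (suc zero) zero = _≡_.refl
  sy (suc zero) (suc zero) = _≡_.refl
  sy (suc zero) (suc (suc zero)) = _≡_.refl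
  sy (suc zero) (suc (suc (suc zero))) = _≡_.refl
  sy (suc zero) (suc (suc (suc (suc zero)))) = _≡_.refl
  sy (suc (suc zero)) zero = _≡_.refl
  sy (suc (suc zero)) (suc zero) = _≡_.refl
  sy (suc (suc zero)) (suc (suc zero)) = _≡_.refl
  sy (suc (suc zero)) (suc (suc (suc zero))) = _≡_.refl
  sy (suc (suc zero)) (suc (suc (suc (suc zero)))) = _≡_.refl
  sy (suc (suc (suc zero))) zero = _≡_.refl
  sy (suc (suc (suc zero))) (suc zero) = _≡_.refl
  sy (suc (suc (suc zero))) (suc (suc zero)) = _≡_.refl
  sy (suc (suc (suc zero))) (suc (suc (suc zero))) = _≡_.refl
  sy (suc (suc (suc (suc zero)))) zero = _≡_.refl
  sy (suc (suc (suc (suc zero)))) (suc zero) = _≡_.refl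
  sy (suc (suc (suc (suc zero)))) (suc (suc zero)) = _≡_.refl
  sy (suc (suc (suc (suc zero)))) (suc (suc (suc (suc zero)))) = _≡_.refl

module Submission where

-- Fix a vertex v. A P3 or a triangle among the neighbours of v would form a diamond or a K4
-- with v, so the neighbourhood induces a matching and needs two colours. The non-neighbours
-- induce a (2P1+P2)-free graph H, and three colours for H, one shared with v, suffice:
-- * H triangle-free: colour the neighbourhood of a vertex w, then that of a non-neighbour b
--   of w; the rest is independent, since an edge there would form a 2P1+P2 with w and b.
-- * H has a triangle: an edge lies in only one triangle, so each other vertex sees at most one
--   corner. If some z sees no corner, every non-corner vertex other than z is adjacent to z;
--   these form a matching, coloured so that each avoids the colour of the corner it sees.
--   Otherwise the vertices seeing corner i form class i, a clique of at most two vertices, and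
--   every vertex has at most one neighbour in each class. Corner i gets colour i and class i
--   gets i + 1 or i + 2; the vertices lifted to i + 2 must meet each two-vertex class once and
--   be closed along edges from class i to class i + 1, and such a set is found by following
--   these edges backwards from a vertex without a successor, or around a 3-cycle.

open import Data.Nat using (ℕ; zero; suc; s≤s)
open import Data.Fin using (Fin; zero; suc; _<_; join; splitAt)
open import Data.Fin.Properties using (<-cmp; <-asym; _<?_; any?; all?; splitAt-join)
  renaming (_≟_ to _≟ᶠ_)
open import Data.Fin.Patterns using (0F; 1F; 2F)
open import Data.Bool using (Bool; true; false; not; if_then_else_)
open import Data.Bool.Properties using (not-¬) renaming (_≟_ to _≟ᵇ_)
open import Data.Maybe using (Maybe; just; nothing; maybe′; fromMaybe)
open import Data.Vec using (lookup; []; _∷_)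
open import Data.List using (tabulate; allFin)
open import Data.List.Relation.Unary.All using ([]; _∷_)
open import Data.List.Relation.Unary.All.Properties using (tabulate⁻)
open import Data.List.Relation.Unary.AllPairs using (AllPairs; []; _∷_)
open import Data.Product using (Σ; _×_; _,_; ∃; ∃₂; proj₁; proj₂; curry)
open import Data.Sum using (_⊎_; inj₁; inj₂; map₂)
open import Data.Sum.Properties using (inj₁-injective; inj₂-injective)
open import Data.Empty using (⊥; ⊥-elim)
open import Function using (_∘_; _$_)
open import Function.Definitions using (Injective)
open import Relation.Binary using (tri<; tri≈; tri>)
open import Relation.Binary.PropositionalEquality as ≡ using (_≡_; _≢_; refl; trans; subst; cong)
open import Relation.Nullary using (¬_; Dec; yes; no; does)
open import Relation.Nullary.Decidable using (_×-dec_; _⊎-dec_; _→-dec_; ¬?; dec-true; dec-false)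
open import Relation.Unary using (Decidable)
open import Defs

tabulate⁻-< : ∀ {a r} {A : Set a} {R : A → A → Set r} {k} {f : Fin k → A} →
              AllPairs R (tabulate f) → ∀ {i j} → i < j → R (f i) (f j)
tabulate⁻-< (Rf0 ∷ _)  {zero}  {suc j} _         = tabulate⁻ Rf0 j
tabulate⁻-< (_ ∷ Rfs) {suc i} {suc j} (s≤s i<j) = tabulate⁻-< Rfs i<j

<?-flips : ∀ {n} {u x : Fin n} → u ≢ x → does (x <? u) ≢ does (u <? x)
<?-flips {u = u} {x} u≢x with <-cmp u x
... | tri< u<x _ _ rewrite dec-true (u <? x) u<x | dec-false (x <? u) (<-asym u<x) = λ ()
... | tri≈ _ u≡x _ = ⊥-elim (u≢x u≡x)
... | tri> _ _ x<u rewrite dec-true (x <? u) x<u | dec-false (u <? x) (<-asym x<u) = λ ()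

next : Fin 3 → Fin 3
next 0F = 1F
next 1F = 2F
next 2F = 0F

next³ : ∀ i → next (next (next i)) ≡ i
next³ 0F = refl
next³ 1F = refl
next³ 2F = refl

next-injective : ∀ {i j} → next i ≡ next j → i ≡ j
next-injective {i} {j} e = trans (≡.sym (next³ i)) (trans (cong (next ∘ next) e) (next³ j))

next≢ : ∀ i → next i ≢ i
next≢ 0F ()
next≢ 1F ()
next≢ 2F ()

next²≢ : ∀ i → next (next i) ≢ i
next²≢ 0F ()
next²≢ 1F ()
next²≢ 2F ()

classify : ∀ i j → j ≡ i ⊎ j ≡ next i ⊎ j ≡ next (next i)
classify 0F 0F = inj₁ refl
classify 0F 1F = inj₂ (inj₁ refl)
classify 0F 2F = inj₂ (inj₂ refl)
classify 1F 0F = inj₂ (inj₂ refl)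
classify 1F 1F = inj₁ refl
classify 1F 2F = inj₂ (inj₁ refl)
classify 2F 0F = inj₂ (inj₁ refl)
classify 2F 1F = inj₂ (inj₂ refl)
classify 2F 2F = inj₁ refl

third : ∀ {i j} → i ≢ j → ∃ λ k → k ≢ i × k ≢ j
third {i} {j} i≢j with classify i j
... | inj₁ refl        = ⊥-elim (i≢j refl)
... | inj₂ (inj₁ refl) = next (next i) , next²≢ i , next≢ (next i)
... | inj₂ (inj₂ refl) = next i , next≢ i , λ e → next≢ (next i) (≡.sym e)

step : Bool → Fin 3 → Fin 3
step b i = if b then next i else i

next∘step≢ : ∀ b i → next (step b i) ≢ i
next∘step≢ false = next≢
next∘step≢ true  = next²≢

next∘step-collision : ∀ {b b′ i j} → next (step b i) ≡ next (step b′ j) →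
  (j ≡ i × b ≡ b′) ⊎
  (j ≡ next i × b ≡ true × b′ ≡ false) ⊎
  (i ≡ next j × b ≡ false × b′ ≡ true)
next∘step-collision {false} {false} e = inj₁ (≡.sym (next-injective e) , refl)
next∘step-collision {true}  {true}  e = inj₁ (≡.sym (next-injective (next-injective e)) , refl)
next∘step-collision {true}  {false} e = inj₂ (inj₁ (≡.sym (next-injective e) , refl , refl))
next∘step-collision {false} {true}  e = inj₂ (inj₂ (next-injective e , refl , refl))

bit : Bool → Fin 2
bit false = 0F
bit true  = 1F

bit-injective : Injective _≡_ _≡_ bit
bit-injective {false} {false} _ = refl
bit-injective {true}  {true}  _ = refl

encode : Fin 3 ⊎ Bool → Fin 5
encode = join 3 2 ∘ map₂ bit

join-injective : ∀ m n → Injective _≡_ _≡_ (join m n)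
join-injective m n {a} {b} e =
  trans (≡.sym (splitAt-join m n a)) (trans (cong (splitAt m) e) (splitAt-join m n b))

encode-injective : Injective _≡_ _≡_ encode
encode-injective {inj₁ _} {inj₁ _} e = cong inj₁ (inj₁-injective (join-injective 3 2 e))
encode-injective {inj₂ _} {inj₂ _} e = cong inj₂ (bit-injective (inj₂-injective (join-injective 3 2 e)))
encode-injective {inj₁ i} {inj₂ b} e with () ← join-injective 3 2 {inj₁ i} {inj₂ (bit b)} e
encode-injective {inj₂ b} {inj₁ i} e with () ← join-injective 3 2 {inj₂ (bit b)} {inj₁ i} e

module _ {n : ℕ} (G : Graph n) where

  infix 4 _~_ _≁_ _~?_ _≁?_

  _~_ _≁_ : Fin n → Fin n → Set
  x ~ y = adj G x y ≡ true
  x ≁ y = adj G x y ≡ false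

  _~?_ : ∀ x y → Dec (x ~ y)
  x ~? y = adj G x y ≟ᵇ true

  _≁?_ : ∀ x y → Dec (x ≁ y)
  x ≁? y = adj G x y ≟ᵇ false

  ~-sym : ∀ {x y} → x ~ y → y ~ x
  ~-sym {x} {y} = trans (sym G y x)

  ≁-sym : ∀ {x y} → x ≁ y → y ≁ x
  ≁-sym {x} {y} = trans (sym G y x)

  ~∧≁⇒⊥ : ∀ {x y} → x ~ y → x ≁ y → ⊥
  ~∧≁⇒⊥ x~y x≁y with () ← trans (≡.sym x~y) x≁y

  ~⇒≢ : ∀ {x y} → x ~ y → x ≢ y
  ~⇒≢ {x} x~y refl = ~∧≁⇒⊥ x~y (irrefl G x)

  ≁∧~⇒≢ : ∀ {x y z} → y ≁ z → x ~ z → y ≢ x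
  ≁∧~⇒≢ y≁z x~z refl = ~∧≁⇒⊥ x~z y≁z

  ¬~⇒≁ : ∀ {x y} → ¬ x ~ y → x ≁ y
  ¬~⇒≁ {x} {y} ¬x~y with adj G x y
  ... | true  = ⊥-elim (¬x~y refl)
  ... | false = refl

  ¬≁⇒~ : ∀ {x y} → ¬ x ≁ y → x ~ y
  ¬≁⇒~ {x} {y} ¬x≁y with adj G x y
  ... | true  = refl
  ... | false = ⊥-elim (¬x≁y refl)

  ColouringOn : (Fin n → Set) → ℕ → Set
  ColouringOn S c = Σ (Fin n → Fin c) λ col → ∀ {u x} → S u → S x → u ~ x → col u ≢ col x

  2P1+P2-FreeOn : (Fin n → Set) → Set
  2P1+P2-FreeOn S = ∀ {j k x y} → S j → S k → S x → S y →
    j ≢ k → j ≁ k → j ≁ x → j ≁ y → k ≁ x → k ≁ y → x ~ y → ⊥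

  module _ {k} (H : Graph k) (f : Fin k → Fin n) where

    Preserved NonEdgeSeparated : Fin k → Fin k → Set
    Preserved i j = adj G (f i) (f j) ≡ adj H i j
    NonEdgeSeparated i j = adj H i j ≡ false → f i ≢ f j

    induced : AllPairs Preserved (allFin k) → AllPairs NonEdgeSeparated (allFin k) → H ≤ᵢ G
    induced pres sep = f , injective , preserved
      where
      preserved : ∀ i j → Preserved i j
      preserved i j with <-cmp i j
      ... | tri< i<j _ _  = tabulate⁻-< pres i<j
      ... | tri≈ _ refl _ = trans (irrefl G (f i)) (≡.sym (irrefl H i))
      ... | tri> _ _ j<i  = trans (sym G (f i) (f j)) (trans (tabulate⁻-< pres j<i) (sym H j i))

      separated : ∀ {i j} → i < j → f i ≢ f j
      separated {i} {j} i<j with adj H i j in e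
      ... | false = tabulate⁻-< sep i<j e
      ... | true  = ~⇒≢ (trans (preserved i j) e)

      injective : Injective _≡_ _≡_ f
      injective {i} {j} fi≡fj with <-cmp i j
      ... | tri< i<j _ _ = ⊥-elim (separated i<j fi≡fj)
      ... | tri≈ _ i≡j _ = i≡j
      ... | tri> _ _ j<i = ⊥-elim (separated j<i (≡.sym fi≡fj))

  module MaxDegreeOne
    (M : Fin n → Set) (M? : Decidable M)
    (≤1-neighbour : ∀ {u m m′} → M u → M m → M m′ → m ~ u → m′ ~ u → m ≡ m′)
    (wish : Fin n → Maybe Bool)
    (wishes-differ : ∀ {u x b} → M u → M x → u ~ x → wish u ≡ just b → wish x ≢ just b)
    where

    -- A vertex without a wish takes the opposite of its partner's wish; if neither has one,
    -- the smaller of the two takes false.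
    pushes : Fin n → Fin n → Bool
    pushes m u = maybe′ not (does (m <? u)) (wish m)

    pushed : Fin n → Bool
    pushed u = does (any? λ m → M? m ×-dec m ~? u ×-dec pushes m u ≟ᵇ true)

    colour : Fin n → Bool
    colour u = fromMaybe (pushed u) (wish u)

    pushed-by-neighbour : ∀ {u x} → M u → M x → x ~ u → pushed u ≡ pushes x u
    pushed-by-neighbour {u} {x} Mu Mx x~u
      with any? (λ m → M? m ×-dec m ~? u ×-dec pushes m u ≟ᵇ true)
    ... | yes (m , Mm , m~u , pushes≡true)
      rewrite ≤1-neighbour Mu Mm Mx m~u x~u = ≡.sym pushes≡true
    ... | no ¬pushed with pushes x u in e
    ...   | true  = ⊥-elim (¬pushed (x , Mx , x~u , e))
    ...   | false = refl

    colour-wish : ∀ {u b} → wish u ≡ just b → colour u ≡ b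
    colour-wish e rewrite e = refl

    colour-proper : ∀ {u x} → M u → M x → u ~ x → colour u ≢ colour x
    colour-proper {u} {x} Mu Mx u~x with wish u in eu | wish x in ex
    ... | just b | just b′ =
      λ b≡b′ → wishes-differ Mu Mx u~x eu (trans ex (cong just (≡.sym b≡b′)))
    ... | just b | nothing
      rewrite pushed-by-neighbour Mx Mu u~x | eu = not-¬ refl
    ... | nothing | just b
      rewrite pushed-by-neighbour Mu Mx (~-sym u~x) | ex = λ e → not-¬ refl (≡.sym e)
    ... | nothing | nothing
      rewrite pushed-by-neighbour Mu Mx (~-sym u~x) | pushed-by-neighbour Mx Mu u~x | eu | ex
      = <?-flips (~⇒≢ u~x)

  module _ (K4-free : G Free K4) (diamond-free : G Free K4-e) where

    no-K4 : ∀ {p q r s} → p ~ q → p ~ r → p ~ s → q ~ r → q ~ s → r ~ s → ⊥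
    no-K4 {p} {q} {r} {s} pq pr ps qr qs rs = K4-free $ induced K4 (lookup (p ∷ q ∷ r ∷ s ∷ []))
      ((pq ∷ pr ∷ ps ∷ []) ∷ (qr ∷ qs ∷ []) ∷ (rs ∷ []) ∷ [] ∷ [])
      (((λ ()) ∷ (λ ()) ∷ (λ ()) ∷ []) ∷ ((λ ()) ∷ (λ ()) ∷ []) ∷ ((λ ()) ∷ []) ∷ [] ∷ [])

    no-diamond : ∀ {p q r s} → p ≢ q → p ≁ q → p ~ r → p ~ s → q ~ r → q ~ s → r ~ s → ⊥
    no-diamond {p} {q} {r} {s} p≢q pq pr ps qr qs rs =
      diamond-free $ induced K4-e (lookup (p ∷ q ∷ r ∷ s ∷ []))
        ((pq ∷ pr ∷ ps ∷ []) ∷ (qr ∷ qs ∷ []) ∷ (rs ∷ []) ∷ [] ∷ [])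
        (((λ _ → p≢q) ∷ (λ ()) ∷ (λ ()) ∷ []) ∷ ((λ ()) ∷ (λ ()) ∷ []) ∷ ((λ ()) ∷ []) ∷ [] ∷ [])

    triangle-apex-unique : ∀ {p q r s} → r ~ s → p ~ r → p ~ s → q ~ r → q ~ s → p ≡ q
    triangle-apex-unique {p} {q} rs pr ps qr qs with p ≟ᶠ q
    ... | yes p≡q = p≡q
    ... | no p≢q with adj G p q in pq
    ...   | true  = ⊥-elim (no-K4 pq pr ps qr qs rs)
    ...   | false = ⊥-elim (no-diamond p≢q pq pr ps qr qs rs)

    module ThreeColouring (S : Fin n → Set) (S? : Decidable S) (S-free : 2P1+P2-FreeOn S) where

      TriangleFreeOn : Set
      TriangleFreeOn = ∀ {a b c} → S a → S b → S c → a ~ b → b ~ c → c ~ a → ⊥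

      module TriangleFree (triangle-free : TriangleFreeOn) where

        colouring-by-neighbourhoods : ∀ {w b} → S w → S b →
          (∀ {u x} → S u → S x → w ≁ u → b ≁ u → w ≁ x → b ≁ x → u ~ x → ⊥) →
          ColouringOn S 3
        colouring-by-neighbourhoods {w} {b} Sw Sb rest-independent = colour , proper
          where
          colour : Fin n → Fin 3
          colour u = if adj G w u then 1F else if adj G b u then 2F else 0F

          proper : ∀ {u x} → S u → S x → u ~ x → colour u ≢ colour x
          proper {u} {x} Su Sx u~x with adj G w u in wu | adj G w x in wx
          ... | true  | true  = λ _ → triangle-free Sw Su Sx wu u~x (~-sym wx)
          ... | true  | false with adj G b x
          ...   | true  = λ ()
          ...   | false = λ ()
          proper {u} {x} Su Sx u~x | false | true with adj G b u
          ...   | true  = λ ()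
          ...   | false = λ ()
          proper {u} {x} Su Sx u~x | false | false with adj G b u in bu | adj G b x in bx
          ...   | true  | true  = λ _ → triangle-free Sb Su Sx bu u~x (~-sym bx)
          ...   | true  | false = λ ()
          ...   | false | true  = λ ()
          ...   | false | false = λ _ → rest-independent Su Sx wu bu wx bx u~x

        colouring : ColouringOn S 3
        colouring with any? S?
        ... | no ∄S = (λ _ → 0F) , λ Su → ⊥-elim (∄S (_ , Su))
        ... | yes (w , Sw) with any? (λ b → S? b ×-dec ¬? (b ≟ᶠ w) ×-dec w ≁? b)
        ...   | yes (b , Sb , b≢w , w≁b) = colouring-by-neighbourhoods Sw Sb
          λ Su Sx w≁u b≁u w≁x b≁x u~x →
            S-free Sw Sb Su Sx (λ e → b≢w (≡.sym e)) w≁b w≁u w≁x b≁u b≁x u~x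
        ...   | no ∄b = colouring-by-neighbourhoods Sw Sw only-w
          where
          non-neighbour-is-w : ∀ {u} → S u → w ≁ u → u ≡ w
          non-neighbour-is-w {u} Su w≁u with u ≟ᶠ w
          ... | yes u≡w = u≡w
          ... | no u≢w  = ⊥-elim (∄b (u , Su , u≢w , w≁u))

          only-w : ∀ {u x} → S u → S x → w ≁ u → w ≁ u → w ≁ x → w ≁ x → u ~ x → ⊥
          only-w Su Sx w≁u _ w≁x _ u~x with refl ← non-neighbour-is-w Su w≁u = ~∧≁⇒⊥ u~x w≁x

      record Triangle : Set where
        field
          corner   : Fin 3 → Fin n
          corner-S : ∀ i → S (corner i)
          corner-~ : ∀ {i j} → i ≢ j → corner i ~ corner j

      module WithTriangle (T : Triangle) where
        open Triangle T

        Member : Fin 3 → Fin n → Set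
        Member i u = S u × u ~ corner i × (∀ j → j ≢ i → u ≁ corner j)

        member? : ∀ i u → Dec (Member i u)
        member? i u = S? u ×-dec u ~? corner i ×-dec all? (λ j → ¬? (j ≟ᶠ i) →-dec u ≁? corner j)

        member-S : ∀ {i u} → Member i u → S u
        member-S = proj₁

        member-~ : ∀ {i u} → Member i u → u ~ corner i
        member-~ = proj₁ ∘ proj₂

        member-≁ : ∀ {i j u} → Member i u → j ≢ i → u ≁ corner j
        member-≁ m = proj₂ (proj₂ m) _

        two-corners : ∀ {u i j} → u ~ corner i → u ~ corner j → i ≢ j → ∃ λ k → u ≡ corner k
        two-corners u~ci u~cj i≢j with k , k≢i , k≢j ← third i≢j =
          k , triangle-apex-unique (corner-~ i≢j) u~ci u~cj (corner-~ k≢i) (corner-~ k≢j)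

        member-unique : ∀ {i j u} → Member i u → Member j u → i ≡ j
        member-unique {i} {j} mi mj with j ≟ᶠ i
        ... | yes j≡i = ≡.sym j≡i
        ... | no j≢i  = ⊥-elim (~∧≁⇒⊥ (member-~ mj) (member-≁ mi j≢i))

        member-not-corner : ∀ {i j u} → Member i u → u ≢ corner j
        member-not-corner {i} {j} m with j ≟ᶠ i
        ... | yes refl = ~⇒≢ (member-~ m)
        ... | no j≢i with k , k≢j , k≢i ← third j≢i =
          λ { refl → ~∧≁⇒⊥ (corner-~ (λ e → k≢j (≡.sym e))) (member-≁ m k≢i) }

        data Position (u : Fin n) : Set where
          at-corner : ∀ i → u ≡ corner i → Position u
          member    : ∀ i → Member i u → Position u
          other     : (S u → ∀ i → u ≁ corner i) → Position u

        position : ∀ u → Position u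
        position u with any? (λ i → u ≟ᶠ corner i)
        ... | yes (i , u≡ci) = at-corner i u≡ci
        ... | no not-corner with S? u
        ...   | no ¬Su = other (λ Su → ⊥-elim (¬Su Su))
        ...   | yes Su with any? (λ i → u ~? corner i)
        ...     | no ¬adj = other (λ _ i → ¬~⇒≁ (λ u~ci → ¬adj (i , u~ci)))
        ...     | yes (i , u~ci) = member i (Su , u~ci , λ j j≢i →
                    ¬~⇒≁ (λ u~cj → not-corner (two-corners u~ci u~cj (λ e → j≢i (≡.sym e)))))

        class-clique : ∀ {i u x} → Member i u → Member i x → u ≢ x → u ~ x
        class-clique {i} mu mx u≢x = ¬≁⇒~ λ u≁x →
          S-free (member-S mu) (member-S mx) (corner-S _) (corner-S _) u≢x u≁x
            (member-≁ mu (next≢ i)) (member-≁ mu (next²≢ i))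
            (member-≁ mx (next≢ i)) (member-≁ mx (next²≢ i))
            (corner-~ λ e → next≢ (next i) (≡.sym e))

        class-≤2 : ∀ {i u x y} → Member i u → Member i x → Member i y → u ≢ x → u ≢ y → x ≢ y → ⊥
        class-≤2 mu mx my u≢x u≢y x≢y =
          no-K4 (class-clique mu mx u≢x) (class-clique mu my u≢y) (member-~ mu)
                (class-clique mx my x≢y) (member-~ mx) (member-~ my)

        one-neighbour-in-class : ∀ {i x y y′} → Member i y → Member i y′ →
          x ~ y → x ~ y′ → x ≢ corner i → y ≡ y′
        one-neighbour-in-class {y = y} {y′} my my′ x~y x~y′ x≢ci with y ≟ᶠ y′
        ... | yes y≡y′ = y≡y′
        ... | no y≢y′  = ⊥-elim (x≢ci (triangle-apex-unique (class-clique my my′ y≢y′)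
                           x~y x~y′ (~-sym (member-~ my)) (~-sym (member-~ my′))))

        pair-dominates : ∀ {i j x y y′} → i ≢ j → Member i x → Member j y → Member j y′ → y ≢ y′ →
          x ~ y ⊎ x ~ y′
        pair-dominates {x = x} {y} {y′} i≢j mx my my′ y≢y′ with x ~? y | x ~? y′
        ... | yes x~y | _        = inj₁ x~y
        ... | no _    | yes x~y′ = inj₂ x~y′
        ... | no x≁y  | no x≁y′  with l , l≢i , l≢j ← third i≢j = ⊥-elim
          (S-free (member-S mx) (corner-S l) (member-S my) (member-S my′)
            (member-not-corner mx) (member-≁ mx l≢i) (¬~⇒≁ x≁y) (¬~⇒≁ x≁y′)
            (≁-sym (member-≁ my l≢j)) (≁-sym (member-≁ my′ l≢j)) (class-clique my my′ y≢y′))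

        module Outer {z} (Sz : S z) (z-outer : ∀ i → z ≁ corner i) where

          z≢corner : ∀ i → z ≢ corner i
          z≢corner i = ≁∧~⇒≢ (z-outer (next i)) (corner-~ λ e → next≢ i (≡.sym e))

          dominates : ∀ {u} → S u → (∀ i → u ≢ corner i) → u ≢ z → u ~ z
          dominates {u} Su not-corner u≢z = ¬≁⇒~ λ u≁z → avoids-edge (position u) u≁z
            where
            avoids-edge : Position u → u ≁ z → ⊥
            avoids-edge (at-corner i u≡ci) _ = not-corner i u≡ci
            avoids-edge (member i mu) u≁z =
              S-free Su Sz (corner-S _) (corner-S _) u≢z u≁z
                (member-≁ mu (next≢ i)) (member-≁ mu (next²≢ i)) (z-outer _) (z-outer _)
                (corner-~ λ e → next≢ (next i) (≡.sym e))
            avoids-edge (other u-outer) u≁z =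
              S-free Su Sz (corner-S 0F) (corner-S 1F) u≢z u≁z
                (u-outer Su 0F) (u-outer Su 1F) (z-outer 0F) (z-outer 1F) (corner-~ λ ())

          Neighbour : Fin n → Set
          Neighbour u = S u × u ~ z

          -- With shade below, a wish keeps a neighbour of z off the colour of the corner it sees.
          wish : Fin n → Maybe Bool
          wish u with u ~? corner 1F | u ~? corner 2F
          ... | yes _ | _     = just true
          ... | no _  | yes _ = just false
          ... | no _  | no _  = nothing

          wished-corner : Bool → Fin 3
          wished-corner b = if b then 1F else 2F

          wish-corner : ∀ {u b} → wish u ≡ just b → u ~ corner (wished-corner b)
          wish-corner {u} e with u ~? corner 1F | u ~? corner 2F
          wish-corner refl | yes u~c1 | _        = u~c1
          wish-corner refl | no _     | yes u~c2 = u~c2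

          open MaxDegreeOne Neighbour (λ u → S? u ×-dec u ~? z)
            (λ (_ , u~z) (_ , m~z) (_ , m′~z) m~u m′~u → triangle-apex-unique u~z m~u m~z m′~u m′~z)
            wish
            (λ {_} {_} {b} (_ , u~z) (_ , x~z) u~x wu wx → z≢corner (wished-corner b)
              (triangle-apex-unique u~x (~-sym u~z) (~-sym x~z)
                (~-sym (wish-corner wu)) (~-sym (wish-corner wx))))

          shade : Bool → Fin 3
          shade b = if b then 2F else 1F

          shade-injective : ∀ {b b′} → shade b ≡ shade b′ → b ≡ b′
          shade-injective {false} {false} _ = refl
          shade-injective {true}  {true}  _ = refl

          shade≢0 : ∀ b → shade b ≢ 0F
          shade≢0 false ()
          shade≢0 true  ()

          wish-1 : ∀ {u} → u ~ corner 1F → wish u ≡ just true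
          wish-1 {u} u~c1 with u ~? corner 1F
          ... | yes _    = refl
          ... | no ¬u~c1 = ⊥-elim (¬u~c1 u~c1)

          wish-2 : ∀ {u} → ¬ u ~ corner 1F → u ~ corner 2F → wish u ≡ just false
          wish-2 {u} ¬u~c1 u~c2 with u ~? corner 1F | u ~? corner 2F
          ... | yes u~c1 | _        = ⊥-elim (¬u~c1 u~c1)
          ... | no _     | yes _    = refl
          ... | no _     | no ¬u~c2 = ⊥-elim (¬u~c2 u~c2)

          shade-avoids-corner : ∀ {u i} → (∀ j → u ≢ corner j) → u ~ corner i → shade (colour u) ≢ i
          shade-avoids-corner {u} {0F} _ _ = shade≢0 (colour u)
          shade-avoids-corner {u} {1F} _ u~c1 rewrite colour-wish (wish-1 u~c1) = λ ()
          shade-avoids-corner {u} {2F} not-corner u~c2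
            rewrite colour-wish (wish-2 (λ u~c1 → let k , u≡ck = two-corners u~c1 u~c2 (λ ()) in
                                           not-corner k u≡ck) u~c2) = λ ()

          apart-is-z : ∀ {u} → S u → (∀ i → u ≢ corner i) → ¬ u ~ z → u ≡ z
          apart-is-z {u} Su not-corner ¬u~z with u ≟ᶠ z
          ... | yes u≡z = u≡z
          ... | no u≢z  = ⊥-elim (¬u~z (dominates Su not-corner u≢z))

          outer-colour : Fin n → Fin 3
          outer-colour u with any? (λ i → u ≟ᶠ corner i) | u ~? z
          ... | yes (i , _) | _     = i
          ... | no _        | yes _ = shade (colour u)
          ... | no _        | no _  = 0F

          outer-proper : ∀ {u x} → S u → S x → u ~ x → outer-colour u ≢ outer-colour x
          outer-proper {u} {x} Su Sx u~x
            with any? (λ i → u ≟ᶠ corner i) | u ~? z | any? (λ i → x ≟ᶠ corner i) | x ~? z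
          ... | yes (i , refl) | _ | yes (j , refl) | _ = ~⇒≢ u~x ∘ cong corner
          ... | yes (i , refl) | _ | no x≢c | yes _ =
            λ e → shade-avoids-corner (curry x≢c) (~-sym u~x) (≡.sym e)
          ... | yes (i , refl) | _ | no x≢c | no ¬x~z with refl ← apart-is-z Sx (curry x≢c) ¬x~z =
            ⊥-elim (~∧≁⇒⊥ (~-sym u~x) (z-outer i))
          ... | no u≢c | yes _ | yes (j , refl) | _ = shade-avoids-corner (curry u≢c) u~x
          ... | no u≢c | no ¬u~z | yes (j , refl) | _ with refl ← apart-is-z Su (curry u≢c) ¬u~z =
            ⊥-elim (~∧≁⇒⊥ u~x (z-outer j))
          ... | no _ | yes u~z | no _ | yes x~z = colour-proper (Su , u~z) (Sx , x~z) u~x ∘ shade-injective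
          ... | no _ | yes _ | no x≢c | no ¬x~z = shade≢0 (colour u)
          ... | no _ | no _ | no _ | yes _ = λ e → shade≢0 (colour x) (≡.sym e)
          ... | no u≢c | no ¬u~z | no x≢c | no ¬x~z = λ _ → ~⇒≢ u~x
            (trans (apart-is-z Su (curry u≢c) ¬u~z) (≡.sym (apart-is-z Sx (λ i → x≢c ∘ (i ,_)) ¬x~z)))

          colouring : ColouringOn S 3
          colouring = outer-colour , outer-proper

        module Classes (no-outer : ∀ {u} → S u → ¬ (∀ i → u ≁ corner i)) where

          Pair : Fin 3 → Set
          Pair i = ∃₂ λ y y′ → Member i y × Member i y′ × y ≢ y′

          pair? : ∀ i → Dec (Pair i)
          pair? i = any? λ y → any? λ y′ → member? i y ×-dec member? i y′ ×-dec ¬? (y ≟ᶠ y′)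

          module Lifting (Lifted : Fin n → Set) (Lifted? : Decidable Lifted)
            (both-in  : ∀ {i u x} → Member i u → Member i x → u ~ x → Lifted u → Lifted x → ⊥)
            (both-out : ∀ {i u x} → Member i u → Member i x → u ~ x → ¬ Lifted u → ¬ Lifted x → ⊥)
            (forward  : ∀ {i u x} → Member i u → Member (next i) x → u ~ x → Lifted u → Lifted x)
            where

            lift : Fin n → Bool
            lift u = does (Lifted? u)

            lift-splits : ∀ {i u x} → Member i u → Member i x → u ~ x → lift u ≢ lift x
            lift-splits {u = u} {x} mu mx u~x with Lifted? u | Lifted? x
            ... | yes Lu  | yes Lx  = λ _ → both-in mu mx u~x Lu Lx
            ... | no ¬Lu  | no ¬Lx  = λ _ → both-out mu mx u~x ¬Lu ¬Lx
            ... | yes _   | no _    = λ ()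
            ... | no _    | yes _   = λ ()

            lift-forward : ∀ {i u x} → Member i u → Member (next i) x → u ~ x →
              lift u ≡ true → lift x ≡ false → ⊥
            lift-forward {u = u} {x} mu mx u~x with Lifted? u | Lifted? x
            ... | yes Lu | no ¬Lx = λ _ _ → ¬Lx (forward mu mx u~x Lu)
            ... | yes _  | yes _  = λ _ ()
            ... | no _   | _      = λ ()

            member-colour : Fin 3 → Fin n → Fin 3
            member-colour i u = next (step (lift u) i)

            colour : Fin n → Fin 3
            colour u with position u
            ... | at-corner i _ = i
            ... | member i _    = member-colour i u
            ... | other _       = 0F

            member-member : ∀ {i j u x} → Member i u → Member j x → u ~ x →
              member-colour i u ≢ member-colour j x
            member-member {i} {j} {u} {x} mu mx u~x e
              with next∘step-collision {lift u} {lift x} {i} {j} e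
            ... | inj₁ (refl , same)          = lift-splits mu mx u~x same
            ... | inj₂ (inj₁ (refl , lu , lx)) = lift-forward mu mx u~x lu lx
            ... | inj₂ (inj₂ (refl , lu , lx)) = lift-forward mx mu (~-sym u~x) lx lu

            corner-member : ∀ {i j x} → x ~ corner i → Member j x → i ≢ member-colour j x
            corner-member {i} {j} {x} x~ci mx i≡colour with i ≟ᶠ j
            ... | yes refl = next∘step≢ (lift x) i (≡.sym i≡colour)
            ... | no i≢j   = ~∧≁⇒⊥ x~ci (member-≁ mx i≢j)

            proper : ∀ {u x} → S u → S x → u ~ x → colour u ≢ colour x
            proper {u} {x} Su Sx u~x with position u | position x
            ... | other o         | _               = ⊥-elim (no-outer Su (o Su))
            ... | _               | other o         = ⊥-elim (no-outer Sx (o Sx))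
            ... | at-corner i refl | at-corner j refl = ~⇒≢ u~x ∘ cong corner
            ... | at-corner i refl | member j mx      = corner-member (~-sym u~x) mx
            ... | member i mu      | at-corner j refl = λ e → corner-member u~x mu (≡.sym e)
            ... | member i mu      | member j mx      = member-member mu mx u~x

            colouring : ColouringOn S 3
            colouring = colour , proper

          no-pairs : (∀ i → ¬ Pair i) → ColouringOn S 3
          no-pairs ∄pair = Lifting.colouring (λ _ → ⊥) (λ _ → no λ ())
            (λ _ _ _ ())
            (λ {i} mu mx u~x _ _ → ∄pair i (_ , _ , mu , mx , ~⇒≢ u~x))
            (λ _ _ _ ())

          module Sink {i x} (mx : Member i x) (sink : ∀ {t} → Member (next i) t → ¬ x ~ t)
                      (¬pair : ¬ Pair (next i)) where

            Lifted : Fin n → Set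
            Lifted u = u ≡ x ⊎ (Member (next (next i)) u × u ~ x)

            Lifted? : Decidable Lifted
            Lifted? u = (u ≟ᶠ x) ⊎-dec (member? (next (next i)) u ×-dec u ~? x)

            both-in : ∀ {j u u′} → Member j u → Member j u′ → u ~ u′ → Lifted u → Lifted u′ → ⊥
            both-in mu mu′ u~u′ (inj₁ refl) (inj₁ refl) = ~⇒≢ u~u′ refl
            both-in mu mu′ u~u′ (inj₁ refl) (inj₂ (mp , _)) =
              next²≢ i (trans (≡.sym (member-unique mu′ mp)) (member-unique mu mx))
            both-in mu mu′ u~u′ (inj₂ (mp , _)) (inj₁ refl) =
              next²≢ i (trans (≡.sym (member-unique mu mp)) (member-unique mu′ mx))
            both-in mu mu′ u~u′ (inj₂ (mp , u~x)) (inj₂ (mp′ , u′~x)) =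
              ~⇒≢ u~u′ (one-neighbour-in-class mp mp′ (~-sym u~x) (~-sym u′~x) (member-not-corner mx))

            both-out : ∀ {j u u′} → Member j u → Member j u′ → u ~ u′ → ¬ Lifted u → ¬ Lifted u′ → ⊥
            both-out {j} mu mu′ u~u′ ¬Lu ¬Lu′ with classify i j
            ... | inj₁ refl = class-≤2 mu mu′ mx (~⇒≢ u~u′) (¬Lu ∘ inj₁) (¬Lu′ ∘ inj₁)
            ... | inj₂ (inj₁ refl) = ¬pair (_ , _ , mu , mu′ , ~⇒≢ u~u′)
            ... | inj₂ (inj₂ refl)
              with pair-dominates (λ e → next²≢ i (≡.sym e)) mx mu mu′ (~⇒≢ u~u′)
            ...   | inj₁ x~u  = ¬Lu (inj₂ (mu , ~-sym x~u))
            ...   | inj₂ x~u′ = ¬Lu′ (inj₂ (mu′ , ~-sym x~u′))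

            forward : ∀ {j u t} → Member j u → Member (next j) t → u ~ t → Lifted u → Lifted t
            forward mu mt u~t (inj₁ refl) with refl ← member-unique mu mx = ⊥-elim (sink mt u~t)
            forward {t = t} mu mt u~t (inj₂ (mp , u~x)) with refl ← member-unique mu mp =
              inj₁ (one-neighbour-in-class (subst (λ k → Member k t) (next³ i) mt) mx u~t u~x
                     (member-not-corner mu))

            colouring : ColouringOn S 3
            colouring = Lifting.colouring Lifted Lifted? both-in both-out forward

          sink-exists : ∀ {i} → Pair i → ¬ Pair (next i) →
            ∃ λ x → Member i x × (∀ {t} → Member (next i) t → ¬ x ~ t)
          sink-exists {i} (y , y′ , my , my′ , y≢y′) ¬pair
            with any? (λ t → member? (next i) t ×-dec y ~? t)
          ... | no ∄t = y , my , λ mt y~t → ∄t (_ , mt , y~t)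
          ... | yes (t , mt , y~t) with any? (λ t′ → member? (next i) t′ ×-dec y′ ~? t′)
          ...   | no ∄t′ = y′ , my′ , λ mt′ y′~t′ → ∄t′ (_ , mt′ , y′~t′)
          ...   | yes (t′ , mt′ , y′~t′) with t ≟ᶠ t′
          ...     | no t≢t′ = ⊥-elim (¬pair (t , t′ , mt , mt′ , t≢t′))
          ...     | yes refl = ⊥-elim (y≢y′ (one-neighbour-in-class my my′ (~-sym y~t) (~-sym y′~t′)
                                  (member-not-corner mt)))

          module Cycle (rep : Fin 3 → Fin n) (rep-member : ∀ j → Member j (rep j))
                       (rep-~ : ∀ j → rep j ~ rep (next j)) where

            Lifted : Fin n → Set
            Lifted u = ∃ λ j → u ≡ rep j

            both-in : ∀ {j u u′} → Member j u → Member j u′ → u ~ u′ → Lifted u → Lifted u′ → ⊥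
            both-in mu mu′ u~u′ (k , refl) (k′ , refl) = ~⇒≢ u~u′ (cong rep
              (trans (member-unique (rep-member k) mu) (≡.sym (member-unique (rep-member k′) mu′))))

            both-out : ∀ {j u u′} → Member j u → Member j u′ → u ~ u′ → ¬ Lifted u → ¬ Lifted u′ → ⊥
            both-out {j} mu mu′ u~u′ ¬Lu ¬Lu′ =
              class-≤2 mu mu′ (rep-member j) (~⇒≢ u~u′) (¬Lu ∘ (j ,_)) (¬Lu′ ∘ (j ,_))

            forward : ∀ {j u t} → Member j u → Member (next j) t → u ~ t → Lifted u → Lifted t
            forward mu mt u~t (k , refl) with refl ← member-unique (rep-member k) mu =
              next k , one-neighbour-in-class mt (rep-member (next k)) u~t (rep-~ k) (member-not-corner mu)

            colouring : ColouringOn S 3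
            colouring = Lifting.colouring Lifted (λ u → any? (λ j → u ≟ᶠ rep j)) both-in both-out forward

          neighbour-in-pair : ∀ {i j x} → i ≢ j → Member i x → Pair j → ∃ λ y → Member j y × x ~ y
          neighbour-in-pair i≢j mx (y , y′ , my , my′ , y≢y′) with pair-dominates i≢j mx my my′ y≢y′
          ... | inj₁ x~y  = y  , my  , x~y
          ... | inj₂ x~y′ = y′ , my′ , x~y′

          another-member : ∀ {j g} → Pair j → Member j g → ∃ λ g′ → Member j g′ × g ≢ g′
          another-member {g = g} (y , y′ , my , my′ , y≢y′) _ with y ≟ᶠ g
          ... | yes refl = y′ , my′ , y≢y′
          ... | no y≢g   = y , my , λ e → y≢g (≡.sym e)

          -- Otherwise a second member g′ of class 1F and h are an independent pair missing the
          -- edge from corner 0F to f.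
          cycle-closes : ∀ {f g g′ h} → Member 0F f → Member 1F g → Member 1F g′ → Member 2F h →
            g ≢ g′ → f ~ g → g ~ h → h ~ f
          cycle-closes mf mg mg′ mh g≢g′ f~g g~h = ¬≁⇒~ λ h≁f →
            S-free (member-S mg′) (member-S mh) (corner-S 0F) (member-S mf)
              (λ { refl → next≢ 1F (≡.sym (member-unique mg′ mh)) })
              (¬~⇒≁ λ g′~h → g≢g′ (one-neighbour-in-class mg mg′ h~g (~-sym g′~h) (member-not-corner mh)))
              (member-≁ mg′ λ ())
              (¬~⇒≁ λ g′~f → g≢g′ (one-neighbour-in-class mg mg′ f~g (~-sym g′~f) (member-not-corner mf)))
              (member-≁ mh λ ()) h≁f (~-sym (member-~ mf))
            where h~g = ~-sym g~h

          all-pairs : (∀ j → Pair j) → ColouringOn S 3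
          all-pairs pair
            with f , _ , mf , _ ← pair 0F
            with g , mg , f~g ← neighbour-in-pair (λ ()) mf (pair 1F)
            with h , mh , g~h ← neighbour-in-pair (λ ()) mg (pair 2F)
            with g′ , mg′ , g≢g′ ← another-member (pair 1F) mg
            = Cycle.colouring (lookup (f ∷ g ∷ h ∷ [])) rep-member rep-~
            where
            rep-member : ∀ j → Member j (lookup (f ∷ g ∷ h ∷ []) j)
            rep-member 0F = mf
            rep-member 1F = mg
            rep-member 2F = mh

            rep-~ : ∀ j → lookup (f ∷ g ∷ h ∷ []) j ~ lookup (f ∷ g ∷ h ∷ []) (next j)
            rep-~ 0F = f~g
            rep-~ 1F = g~h
            rep-~ 2F = cycle-closes mf mg mg′ mh g≢g′ f~g g~h

          module _ (no-boundary : ¬ ∃ λ i → Pair i × ¬ Pair (next i)) where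

            propagate : ∀ {i} → Pair i → Pair (next i)
            propagate {i} p with pair? (next i)
            ... | yes p′ = p′
            ... | no ¬p′ = ⊥-elim (no-boundary (i , p , ¬p′))

            pairs-everywhere : Pair 0F → ∀ j → Pair j
            pairs-everywhere p0 0F = p0
            pairs-everywhere p0 1F = propagate p0
            pairs-everywhere p0 2F = propagate (propagate p0)

            pairs-nowhere : ¬ Pair 0F → ∀ j → ¬ Pair j
            pairs-nowhere ¬p0 0F = ¬p0
            pairs-nowhere ¬p0 1F = ¬p0 ∘ propagate ∘ propagate
            pairs-nowhere ¬p0 2F = ¬p0 ∘ propagate

          colouring : ColouringOn S 3
          colouring with any? (λ i → pair? i ×-dec ¬? (pair? (next i)))
          ... | yes (i , pair , ¬pair) with x , mx , sink ← sink-exists pair ¬pair = Sink.colouring mx sink ¬pair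
          ... | no no-boundary with pair? 0F
          ...   | yes p0 = all-pairs (pairs-everywhere no-boundary p0)
          ...   | no ¬p0 = no-pairs (pairs-nowhere no-boundary ¬p0)

        colouring : ColouringOn S 3
        colouring with any? (λ z → S? z ×-dec all? (λ i → z ≁? corner i))
        ... | yes (z , Sz , z-outer) = Outer.colouring Sz z-outer
        ... | no ∄outer = Classes.colouring (λ Su u-outer → ∄outer (_ , Su , u-outer))

      triangle : ∀ {a b c} → S a → S b → S c → a ~ b → b ~ c → c ~ a → Triangle
      triangle {a} {b} {c} Sa Sb Sc ab bc ca = record
        { corner = lookup (a ∷ b ∷ c ∷ []) ; corner-S = corner-S ; corner-~ = corner-~ }
        where
        corner-S : ∀ i → S (lookup (a ∷ b ∷ c ∷ []) i)
        corner-S 0F = Sa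
        corner-S 1F = Sb
        corner-S 2F = Sc

        corner-~ : ∀ {i j} → i ≢ j → lookup (a ∷ b ∷ c ∷ []) i ~ lookup (a ∷ b ∷ c ∷ []) j
        corner-~ {0F} {1F} _ = ab
        corner-~ {0F} {2F} _ = ~-sym ca
        corner-~ {1F} {0F} _ = ~-sym ab
        corner-~ {1F} {2F} _ = bc
        corner-~ {2F} {0F} _ = ca
        corner-~ {2F} {1F} _ = ~-sym bc
        corner-~ {0F} {0F} i≢j = ⊥-elim (i≢j refl)
        corner-~ {1F} {1F} i≢j = ⊥-elim (i≢j refl)
        corner-~ {2F} {2F} i≢j = ⊥-elim (i≢j refl)

      colouring : ColouringOn S 3
      colouring with any? (λ a → any? λ b → any? λ c →
                       S? a ×-dec S? b ×-dec S? c ×-dec a ~? b ×-dec b ~? c ×-dec c ~? a)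
      ... | yes (a , b , c , Sa , Sb , Sc , ab , bc , ca) = WithTriangle.colouring (triangle Sa Sb Sc ab bc ca)
      ... | no ∄triangle = TriangleFree.colouring λ Sa Sb Sc ab bc ca →
                             ∄triangle (_ , _ , _ , Sa , Sb , Sc , ab , bc , ca)

  non-neighbours-2P1+P2-free : G Free 3P1+P2 → ∀ v → 2P1+P2-FreeOn (λ u → u ≢ v × v ≁ u)
  non-neighbours-2P1+P2-free P-free v {j} {k} {x} {y}
    (j≢v , v≁j) (k≢v , v≁k) (_ , v≁x) (_ , v≁y) j≢k j≁k j≁x j≁y k≁x k≁y x~y =
    P-free $ induced 3P1+P2 (lookup (v ∷ j ∷ k ∷ x ∷ y ∷ []))
      ((v≁j ∷ v≁k ∷ v≁x ∷ v≁y ∷ []) ∷ (j≁k ∷ j≁x ∷ j≁y ∷ []) ∷ (k≁x ∷ k≁y ∷ []) ∷ (x~y ∷ [])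
       ∷ [] ∷ [])
      (((λ _ → j≢v ∘ ≡.sym) ∷ (λ _ → k≢v ∘ ≡.sym)
         ∷ (λ _ → ≁∧~⇒≢ v≁y x~y) ∷ (λ _ → ≁∧~⇒≢ v≁x y~x) ∷ [])
       ∷ ((λ _ → j≢k) ∷ (λ _ → ≁∧~⇒≢ j≁y x~y) ∷ (λ _ → ≁∧~⇒≢ j≁x y~x) ∷ [])
       ∷ ((λ _ → ≁∧~⇒≢ k≁y x~y) ∷ (λ _ → ≁∧~⇒≢ k≁x y~x) ∷ [])
       ∷ ((λ ()) ∷ []) ∷ [] ∷ [])
    where y~x = ~-sym x~y

  five-colouring : G Free 3P1+P2 → G Free K4-e → G Free K4 → Fin n → Colourable G 5
  five-colouring P-free diamond-free K4-free v = encode ∘ colour , λ u x u~x → proper u~x ∘ encode-injective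
    where
    open ThreeColouring K4-free diamond-free (λ u → u ≢ v × v ≁ u) (λ u → ¬? (u ≟ᶠ v) ×-dec v ≁? u)
      (non-neighbours-2P1+P2-free P-free v)
      using () renaming (colouring to far)
    open MaxDegreeOne (v ~_) (v ~?_)
      (λ v~u v~m v~m′ m~u m′~u →
        triangle-apex-unique K4-free diamond-free v~u (~-sym v~m) m~u (~-sym v~m′) m′~u)
      (λ _ → nothing) (λ _ _ _ ())
      using () renaming (colour to near; colour-proper to near-proper)

    colour : Fin n → Fin 3 ⊎ Bool
    colour u with u ≟ᶠ v | v ~? u
    ... | yes _ | _     = inj₁ 0F
    ... | no _  | yes _ = inj₂ (near u)
    ... | no _  | no _  = inj₁ (proj₁ far u)

    proper : ∀ {u x} → u ~ x → colour u ≢ colour x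
    proper {u} {x} u~x with u ≟ᶠ v | v ~? u | x ≟ᶠ v | v ~? x
    ... | yes refl | _        | yes refl | _        = λ _ → ~⇒≢ u~x refl
    ... | yes refl | _        | no _     | yes _    = λ ()
    ... | yes refl | _        | no _     | no ¬v~x  = ⊥-elim (¬v~x u~x)
    ... | no _     | yes _    | yes refl | _        = λ ()
    ... | no _     | no ¬v~u  | yes refl | _        = ⊥-elim (¬v~u (~-sym u~x))
    ... | no _     | yes v~u  | no _     | yes v~x  = near-proper v~u v~x u~x ∘ inj₂-injective
    ... | no _     | yes _    | no _     | no _     = λ ()
    ... | no _     | no _     | no _     | yes _    = λ ()
    ... | no u≢v   | no ¬v~u  | no x≢v   | no ¬v~x  =
      proj₂ far (u≢v , ¬~⇒≁ ¬v~u) (x≢v , ¬~⇒≁ ¬v~x) u~x ∘ inj₁-injective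

lemma6p9 : ∀ {n} (G : Graph n) → G Free 3P1+P2 → G Free K4-e → G Free K4 →
    Colourable G 5
lemma6p9 {zero}  G _ _ _ = (λ ()) , λ ()
lemma6p9 {suc n} G P-free diamond-free K4-free = five-colouring G P-free diamond-free K4-free 0F
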